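{- Let $\Gamma$ be a context, $r,s$ terms of Polymorphic System I and $A$ a type. If $\Gamma\vdash r:A$ and either $r\hookrightarrow s$ or $r\rightleftarrows s$, then $\Gamma\vdash s:A$.
   Context: Polymorphic System I (PSI). Types: $A ::= X \mid A\Rightarrow A \mid A\wedge A \mid \forall X.A$, with $X$ ranging over type variables; $FTV(A)$ is the set of free type variables; types and terms are taken modulo $\alpha$-equivalence; $\Rightarrow$ associates to the right. Type isomorphism $\equiv$ is the smallest congruence on types containing: $A\wedge B\equiv B\wedge A$; $A\wedge(B\wedge C)\equiv(A\wedge B)\wedge C$; $A\Rightarrow(B\wedge C)\equiv(A\Rightarrow B)\wedge(A\Rightarrow C)$; $(A\wedge B)\Rightarrow C\equiv A\Rightarrow B\Rightarrow C$; $\forall X.(A\Rightarrow B)\equiv A\Rightarrow\forall X.B$ if $X\notin FTV(A)$; $\forall X.(A\wedge B)\equiv\forall X.A\wedge\forall X.B$. Terms (Church style, variables carry types): $r ::= x^A \mid \lambda x^A.r \mid rr \mid \langle r,r\rangle \mid \pi_A(r) \mid \Lambda X.r \mid r[A]$. Typing rules: $\Gamma,x:A\vdash x:A$; from $\Gamma\vdash r:A$ and $A\equiv B$ infer $\Gamma\vdash r:B$; from $\Gamma,x:A\vdash r:B$ infer $\Gamma\vdash\lambda x^A.r:A\Rightarrow B$; from $\Gamma\vdash r:A\Rightarrow B$ and $\Gamma\vdash s:A$ infer $\Gamma\vdash rs:B$; from $\Gamma\vdash r:A$ and $\Gamma\vdash s:B$ infer $\Gamma\vdash\langle r,s\rangle:A\wedge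 B$; from $\Gamma\vdash r:A\wedge B$ infer $\Gamma\vdash\pi_A(r):A$; from $\Gamma\vdash r:A$ and $X\notin FTV(\Gamma)$ infer $\Gamma\vdash\Lambda X.r:\forall X.A$; from $\Gamma\vdash r:\forall X.A$ infer $\Gamma\vdash r[B]:[X:=B]A$. Term equivalence $\rightleftarrows$ is the symmetric relation, closed under all term constructors (if $r\rightleftarrows s$ then $\lambda x^A.r\rightleftarrows\lambda x^A.s$, $rt\rightleftarrows st$, $tr\rightleftarrows ts$, $\langle t,r\rangle\rightleftarrows\langle t,s\rangle$, $\langle r,t\rangle\rightleftarrows\langle s,t\rangle$, $\pi_A(r)\rightleftarrows\pi_A(s)$, $\Lambda X.r\rightleftarrows\Lambda X.s$, $r[A]\rightleftarrows s[A]$), generated by: $\langle r,s\rangle\rightleftarrows\langle s,r\rangle$; $\langle r,\langle s,t\rangle\rangle\rightleftarrows\langle\langle r,s\rangle,t\rangle$; $\lambda x^A.\langle r,s\rangle\rightleftarrows\langle\lambda x^A.r,\lambda x^A.s\rangle$; $\langle r,s\rangle t\rightleftarrows\langle rt,st\rangle$; $r\langle s,t\rangle\rightleftarrows (rs)t$; $\Lambda X.\lambda x^A.r\rightleftarrows\lambda x^A.\Lambda X.r$ if $X\notin FTV(A)$; $(\lambda x^A.r)[B]\rightleftarrows\lambda x^A.(r[B])$ (with side condition $X\notin FTV(A)$ as in the paper); $\Lambda X.\langle r,s\rangle\rightleftarrows\langle\Lambda X.r,\Lambda X.s\rangle$; $\langle r,s\rangle[A]\rightleftarrows\langle r[A],s[A]\rangle$;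 $\pi_{\forall X.A}(\Lambda X.r)\rightleftarrows\Lambda X.\pi_A(r)$; $(\pi_{\forall X.B}(r))[A]\rightleftarrows\pi_{[X:=A]B}(r[A])$ if $\Gamma\vdash r:\forall X.(B\wedge C)$. Reduction $\hookrightarrow$ is the closure under all term constructors of: $(\lambda x^A.r)s\hookrightarrow[x:=s]r$ if $\Gamma\vdash s:A$; $(\Lambda X.r)[A]\hookrightarrow[X:=A]r$; $\pi_A(\langle r,s\rangle)\hookrightarrow r$ if $\Gamma\vdash r:A$. -}

module Defs where

-- Polymorphic System I (PSI), locally presented with de Bruijn indices
-- (for both type variables and term variables), so that types and terms
-- are automatically taken modulo alpha-equivalence.

open import Data.Nat using (ℕ; zero; suc)
open import Data.List using (List; []; _∷_; map)

infixr 7 _⇒_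
infixl 8 _∧_

data Type : Set where
  tv  : ℕ → Type
  _⇒_ : Type → Type → Type
  _∧_ : Type → Type → Type
  all : Type → Type          -- all A  represents  ∀X.A  (X = index 0 in A)

extT : (ℕ → ℕ) → ℕ → ℕ
extT ρ zero    = zero
extT ρ (suc n) = suc (ρ n)

renT : (ℕ → ℕ) → Type → Type
renT ρ (tv n)  = tv (ρ n)
renT ρ (A ⇒ B) = renT ρ A ⇒ renT ρ B
renT ρ (A ∧ B) = renT ρ A ∧ renT ρ B
renT ρ (all A) = all (renT (extT ρ) A)

wkT : Type → Type
wkT = renT suc

extsT : (ℕ → Type) → ℕ → Type
extsT σ zero    = tv zero
extsT σ (suc n) = wkT (σ n)

subT : (ℕ → Type) → Type → Type
subT σ (tv n)  = σ n
subT σ (A ⇒ B) = subT σ A ⇒ subT σ B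
subT σ (A ∧ B) = subT σ A ∧ subT σ B
subT σ (all A) = all (subT (extsT σ) A)

single : Type → ℕ → Type
single B zero    = B
single B (suc n) = tv n

_[0:=_] : Type → Type → Type
A [0:= B ] = subT (single B) A

-- Type isomorphism: smallest congruence containing the six axioms.
-- X ∉ FTV(A) with A outside the binder is rendered as  wkT A  under it.

infix 4 _≅_

data _≅_ : Type → Type → Set where
  ≅-refl  : ∀ {A} → A ≅ A
  ≅-sym   : ∀ {A B} → A ≅ B → B ≅ A
  ≅-trans : ∀ {A B C} → A ≅ B → B ≅ C → A ≅ C
  ≅-⇒     : ∀ {A A' B B'} → A ≅ A' → B ≅ B' → (A ⇒ B) ≅ (A' ⇒ B')
  ≅-∧     : ∀ {A A' B B'} → A ≅ A' → B ≅ B' → (A ∧ B) ≅ (A' ∧ B')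
  ≅-all   : ∀ {A A'} → A ≅ A' → all A ≅ all A'
  comm    : ∀ {A B} → (A ∧ B) ≅ (B ∧ A)
  asso    : ∀ {A B C} → (A ∧ (B ∧ C)) ≅ ((A ∧ B) ∧ C)
  dist    : ∀ {A B C} → (A ⇒ (B ∧ C)) ≅ ((A ⇒ B) ∧ (A ⇒ C))
  curry   : ∀ {A B C} → ((A ∧ B) ⇒ C) ≅ (A ⇒ B ⇒ C)
  p-comm  : ∀ {A B} → all (wkT A ⇒ B) ≅ (A ⇒ all B)
  p-dist  : ∀ {A B} → all (A ∧ B) ≅ (all A ∧ all B)

data Term : Set where
  var  : ℕ → Term
  lam  : Type → Term → Term
  _·_  : Term → Term → Term
  pair : Term → Term → Term
  proj : Type → Term → Term
  Lam  : Term → Term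
  tapp : Term → Type → Term

infixl 9 _·_

renTy : (ℕ → ℕ) → Term → Term
renTy ρ (var x)    = var x
renTy ρ (lam A r)  = lam (renT ρ A) (renTy ρ r)
renTy ρ (r · s)    = renTy ρ r · renTy ρ s
renTy ρ (pair r s) = pair (renTy ρ r) (renTy ρ s)
renTy ρ (proj A r) = proj (renT ρ A) (renTy ρ r)
renTy ρ (Lam r)    = Lam (renTy (extT ρ) r)
renTy ρ (tapp r A) = tapp (renTy ρ r) (renT ρ A)

subTy : (ℕ → Type) → Term → Term
subTy σ (var x)    = var x
subTy σ (lam A r)  = lam (subT σ A) (subTy σ r)
subTy σ (r · s)    = subTy σ r · subTy σ s
subTy σ (pair r s) = pair (subTy σ r) (subTy σ s)
subTy σ (proj A r) = proj (subT σ A) (subTy σ r)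
subTy σ (Lam r)    = Lam (subTy (extsT σ) r)
subTy σ (tapp r A) = tapp (subTy σ r) (subT σ A)

_[T0:=_] : Term → Type → Term
r [T0:= A ] = subTy (single A) r

ren : (ℕ → ℕ) → Term → Term
ren ρ (var x)    = var (ρ x)
ren ρ (lam A r)  = lam A (ren (extT ρ) r)
ren ρ (r · s)    = ren ρ r · ren ρ s
ren ρ (pair r s) = pair (ren ρ r) (ren ρ s)
ren ρ (proj A r) = proj A (ren ρ r)
ren ρ (Lam r)    = Lam (ren ρ r)
ren ρ (tapp r A) = tapp (ren ρ r) A

exts : (ℕ → Term) → ℕ → Term
exts σ zero    = var zero
exts σ (suc n) = ren suc (σ n)

-- going under a type binder shifts the free type variables of substituted terms
extsTy : (ℕ → Term) → ℕ → Term
extsTy σ n = renTy suc (σ n)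

sub : (ℕ → Term) → Term → Term
sub σ (var x)    = σ x
sub σ (lam A r)  = lam A (sub (exts σ) r)
sub σ (r · s)    = sub σ r · sub σ s
sub σ (pair r s) = pair (sub σ r) (sub σ s)
sub σ (proj A r) = proj A (sub σ r)
sub σ (Lam r)    = Lam (sub (extsTy σ) r)
sub σ (tapp r A) = tapp (sub σ r) A

singleTm : Term → ℕ → Term
singleTm s zero    = s
singleTm s (suc n) = var n

_[0:=ₜ_] : Term → Term → Term
r [0:=ₜ s ] = sub (singleTm s) r

Ctx : Set
Ctx = List Type

-- shifting a context when going under ΛX  (replaces the side condition X ∉ FTV(Γ))
wkCtx : Ctx → Ctx
wkCtx = map wkT

infix 4 _∋_⦂_ _⊢_⦂_ _⊢_↪_ _⊢_⇄_

data _∋_⦂_ : Ctx → ℕ → Type → Set where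
  here  : ∀ {Γ A} → (A ∷ Γ) ∋ zero ⦂ A
  there : ∀ {Γ A B n} → Γ ∋ n ⦂ A → (B ∷ Γ) ∋ suc n ⦂ A

data _⊢_⦂_ : Ctx → Term → Type → Set where
  ax   : ∀ {Γ x A} → Γ ∋ x ⦂ A → Γ ⊢ var x ⦂ A
  ≅e   : ∀ {Γ r A B} → Γ ⊢ r ⦂ A → A ≅ B → Γ ⊢ r ⦂ B
  ⇒i   : ∀ {Γ r A B} → (A ∷ Γ) ⊢ r ⦂ B → Γ ⊢ lam A r ⦂ A ⇒ B
  ⇒e   : ∀ {Γ r s A B} → Γ ⊢ r ⦂ A ⇒ B → Γ ⊢ s ⦂ A → Γ ⊢ r · s ⦂ B
  ∧i   : ∀ {Γ r s A B} → Γ ⊢ r ⦂ A → Γ ⊢ s ⦂ B → Γ ⊢ pair r s ⦂ A ∧ B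
  ∧e   : ∀ {Γ r A B} → Γ ⊢ r ⦂ A ∧ B → Γ ⊢ proj A r ⦂ A
  ∀i   : ∀ {Γ r A} → wkCtx Γ ⊢ r ⦂ A → Γ ⊢ Lam r ⦂ all A
  ∀e   : ∀ {Γ r A B} → Γ ⊢ r ⦂ all A → Γ ⊢ tapp r B ⦂ A [0:= B ]

-- Reduction, indexed by the context in which the side conditions are
-- checked (the context grows when going under binders).

data _⊢_↪_ : Ctx → Term → Term → Set where
  β     : ∀ {Γ A r s} → Γ ⊢ s ⦂ A → Γ ⊢ lam A r · s ↪ r [0:=ₜ s ]
  βΛ    : ∀ {Γ r A} → Γ ⊢ tapp (Lam r) A ↪ r [T0:= A ]
  βπ    : ∀ {Γ A r s} → Γ ⊢ r ⦂ A → Γ ⊢ proj A (pair r s) ↪ r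
  c-lam  : ∀ {Γ A r s} → (A ∷ Γ) ⊢ r ↪ s → Γ ⊢ lam A r ↪ lam A s
  c-appl : ∀ {Γ r s t} → Γ ⊢ r ↪ s → Γ ⊢ r · t ↪ s · t
  c-appr : ∀ {Γ r s t} → Γ ⊢ r ↪ s → Γ ⊢ t · r ↪ t · s
  c-pairl : ∀ {Γ r s t} → Γ ⊢ r ↪ s → Γ ⊢ pair r t ↪ pair s t
  c-pairr : ∀ {Γ r s t} → Γ ⊢ r ↪ s → Γ ⊢ pair t r ↪ pair t s
  c-proj : ∀ {Γ A r s} → Γ ⊢ r ↪ s → Γ ⊢ proj A r ↪ proj A s
  c-Lam  : ∀ {Γ r s} → wkCtx Γ ⊢ r ↪ s → Γ ⊢ Lam r ↪ Lam s
  c-tapp : ∀ {Γ A r s} → Γ ⊢ r ↪ s → Γ ⊢ tapp r A ↪ tapp s A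

data _⊢_⇄_ : Ctx → Term → Term → Set where
  e-sym   : ∀ {Γ r s} → Γ ⊢ r ⇄ s → Γ ⊢ s ⇄ r
  e-comm  : ∀ {Γ r s} → Γ ⊢ pair r s ⇄ pair s r
  e-asso  : ∀ {Γ r s t} → Γ ⊢ pair r (pair s t) ⇄ pair (pair r s) t
  e-distλ : ∀ {Γ A r s} → Γ ⊢ lam A (pair r s) ⇄ pair (lam A r) (lam A s)
  e-distapp : ∀ {Γ r s t} → Γ ⊢ pair r s · t ⇄ pair (r · t) (s · t)
  e-curry : ∀ {Γ r s t} → Γ ⊢ r · pair s t ⇄ (r · s) · t
  -- ΛX.λx^A.r ⇄ λx^A.ΛX.r  with X ∉ FTV(A): A under the binder is wkT A
  e-P-comm : ∀ {Γ A r} → Γ ⊢ Lam (lam (wkT A) r) ⇄ lam A (Lam r)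
  -- (λx^A.r)[B] ⇄ λx^A.(r[B]); the side condition X ∉ FTV(A) is automatic here
  e-P-distλ : ∀ {Γ A B r} → Γ ⊢ tapp (lam A r) B ⇄ lam A (tapp r B)
  e-P-distΛpair : ∀ {Γ r s} → Γ ⊢ Lam (pair r s) ⇄ pair (Lam r) (Lam s)
  e-P-distpairtapp : ∀ {Γ A r s} → Γ ⊢ tapp (pair r s) A ⇄ pair (tapp r A) (tapp s A)
  e-P-πΛ : ∀ {Γ A r} → Γ ⊢ proj (all A) (Lam r) ⇄ Lam (proj A r)
  e-P-πtapp : ∀ {Γ A B C r} → Γ ⊢ r ⦂ all (B ∧ C) →
              Γ ⊢ tapp (proj (all B) r) A ⇄ proj (B [0:= A ]) (tapp r A)
  q-lam  : ∀ {Γ A r s} → (A ∷ Γ) ⊢ r ⇄ s → Γ ⊢ lam A r ⇄ lam A s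
  q-appl : ∀ {Γ r s t} → Γ ⊢ r ⇄ s → Γ ⊢ r · t ⇄ s · t
  q-appr : ∀ {Γ r s t} → Γ ⊢ r ⇄ s → Γ ⊢ t · r ⇄ t · s
  q-pairl : ∀ {Γ r s t} → Γ ⊢ r ⇄ s → Γ ⊢ pair r t ⇄ pair s t
  q-pairr : ∀ {Γ r s t} → Γ ⊢ r ⇄ s → Γ ⊢ pair t r ⇄ pair t s
  q-proj : ∀ {Γ A r s} → Γ ⊢ r ⇄ s → Γ ⊢ proj A r ⇄ proj A s
  q-Lam  : ∀ {Γ r s} → wkCtx Γ ⊢ r ⇄ s → Γ ⊢ Lam r ⇄ Lam s
  q-tapp : ∀ {Γ A r s} → Γ ⊢ r ⇄ s → Γ ⊢ tapp r A ⇄ tapp s A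

-- Each typing derivation is a syntax-directed rule followed by an isomorphism step, so both
-- statements reduce to facts about ≅. Reducing a β-redex needs ⇒-cancellation (from A ⇒ B ≅ A′ ⇒ B′
-- and A ≅ A′ infer B ≅ B′) together with uniqueness of types up to ≅; the distributivity equations
-- need to split a conjunction isomorphic to an implication or to a quantified type. These follow from
-- a normal form: every type is isomorphic to a conjunction of prime factors ∀ⁿ.A₁ ⇒ ⋯ ⇒ Aₘ ⇒ X, and
-- A ≅ B holds exactly when the factors of A and B agree up to permutation, each factor up to a
-- permutation of its premises. For quantified types the invariant allBody is enough.
module Submission where

open import Defs
open import Level using (0ℓ)
open import Data.Nat using (ℕ; zero; suc)
open import Data.Bool using (Bool; true; false; T) renaming (_∧_ to _&&_)
open import Data.Bool.Properties using (T-∧) renaming (∧-comm to &&-comm; ∧-assoc to &&-assoc)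
open import Data.List using (List; []; _∷_; _++_; map; foldr; foldl)
import Data.List.Properties as List
open import Data.List.NonEmpty as List⁺ using (List⁺; _∷_; toList; _⁺++⁺_)
import Data.List.NonEmpty.Properties as List⁺
import Data.List.Relation.Binary.Pointwise as Pointwise
open import Data.List.Relation.Binary.Pointwise using (Pointwise; []; _∷_)
import Data.List.Relation.Binary.Permutation.Setoid as PermutationSetoid
import Data.List.Relation.Binary.Permutation.Setoid.Properties as PermutationProperties
import Data.List.Relation.Binary.Equality.Setoid as SetoidEquality
import Relation.Binary.Reasoning.Setoid as SetoidReasoning
open import Relation.Binary.Bundles using (Setoid)
open import Function.Bundles using (Equivalence)
open import Relation.Unary using (Pred; _⊆_; _≐_)
open import Data.Sum using (_⊎_; inj₁; inj₂)
open import Data.Product as Product using (∃-syntax; ∃₂; _×_; _,_; proj₁)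
open import Function using (_∘_)
open import Relation.Binary.PropositionalEquality
  using (_≡_; _≗_; refl; sym; trans; cong; cong₂; subst; subst₂; module ≡-Reasoning)

variable
  Γ Δ : Ctx
  A A′ B B′ C U V : Type
  r s t : Term
  ρ ρ′ : ℕ → ℕ
  σ : ℕ → Type

≅-reflexive : A ≡ B → A ≅ B
≅-reflexive refl = ≅-refl

extT-cong : ∀ {ρ ρ′} → ρ ≗ ρ′ → extT ρ ≗ extT ρ′
extT-cong e zero    = refl
extT-cong e (suc n) = cong suc (e n)

renT-cong : ∀ {ρ ρ′} → ρ ≗ ρ′ → renT ρ ≗ renT ρ′
renT-cong e (tv n)  = cong tv (e n)
renT-cong e (A ⇒ B) = cong₂ _⇒_ (renT-cong e A) (renT-cong e B)
renT-cong e (A ∧ B) = cong₂ _∧_ (renT-cong e A) (renT-cong e B)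
renT-cong e (all A) = cong all (renT-cong (extT-cong e) A)

extsT-cong : ∀ {σ σ′} → σ ≗ σ′ → extsT σ ≗ extsT σ′
extsT-cong e zero    = refl
extsT-cong e (suc n) = cong wkT (e n)

subT-cong : ∀ {σ σ′} → σ ≗ σ′ → subT σ ≗ subT σ′
subT-cong e (tv n)  = e n
subT-cong e (A ⇒ B) = cong₂ _⇒_ (subT-cong e A) (subT-cong e B)
subT-cong e (A ∧ B) = cong₂ _∧_ (subT-cong e A) (subT-cong e B)
subT-cong e (all A) = cong all (subT-cong (extsT-cong e) A)

renT-∘ : ∀ ρ ρ′ A → renT ρ (renT ρ′ A) ≡ renT (ρ ∘ ρ′) A
renT-∘ ρ ρ′ (tv n)  = refl
renT-∘ ρ ρ′ (A ⇒ B) = cong₂ _⇒_ (renT-∘ ρ ρ′ A) (renT-∘ ρ ρ′ B)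
renT-∘ ρ ρ′ (A ∧ B) = cong₂ _∧_ (renT-∘ ρ ρ′ A) (renT-∘ ρ ρ′ B)
renT-∘ ρ ρ′ (all A) = cong all (trans (renT-∘ (extT ρ) (extT ρ′) A)
                                      (renT-cong (λ { zero → refl ; (suc n) → refl }) A))

renT-extT-wkT : ∀ ρ A → renT (extT ρ) (wkT A) ≡ wkT (renT ρ A)
renT-extT-wkT ρ A = trans (renT-∘ (extT ρ) suc A) (sym (renT-∘ suc ρ A))

renT≗subT : ∀ ρ → renT ρ ≗ subT (tv ∘ ρ)
renT≗subT ρ (tv n)  = refl
renT≗subT ρ (A ⇒ B) = cong₂ _⇒_ (renT≗subT ρ A) (renT≗subT ρ B)
renT≗subT ρ (A ∧ B) = cong₂ _∧_ (renT≗subT ρ A) (renT≗subT ρ B)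
renT≗subT ρ (all A) = cong all (trans (renT≗subT (extT ρ) A)
                                      (subT-cong (λ { zero → refl ; (suc n) → refl }) A))

subT-renT : ∀ σ ρ A → subT σ (renT ρ A) ≡ subT (σ ∘ ρ) A
subT-renT σ ρ (tv n)  = refl
subT-renT σ ρ (A ⇒ B) = cong₂ _⇒_ (subT-renT σ ρ A) (subT-renT σ ρ B)
subT-renT σ ρ (A ∧ B) = cong₂ _∧_ (subT-renT σ ρ A) (subT-renT σ ρ B)
subT-renT σ ρ (all A) = cong all (trans (subT-renT (extsT σ) (extT ρ) A)
                                        (subT-cong (λ { zero → refl ; (suc n) → refl }) A))

renT-subT : ∀ ρ σ A → renT ρ (subT σ A) ≡ subT (renT ρ ∘ σ) A
renT-subT ρ σ (tv n)  = refl
renT-subT ρ σ (A ⇒ B) = cong₂ _⇒_ (renT-subT ρ σ A) (renT-subT ρ σ B)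
renT-subT ρ σ (A ∧ B) = cong₂ _∧_ (renT-subT ρ σ A) (renT-subT ρ σ B)
renT-subT ρ σ (all A) = cong all (trans (renT-subT (extT ρ) (extsT σ) A) (subT-cong e A))
  where
  e : renT (extT ρ) ∘ extsT σ ≗ extsT (renT ρ ∘ σ)
  e zero    = refl
  e (suc n) = renT-extT-wkT ρ (σ n)

subT-wkT : ∀ σ A → subT (extsT σ) (wkT A) ≡ wkT (subT σ A)
subT-wkT σ A = trans (subT-renT (extsT σ) suc A) (sym (renT-subT suc σ A))

subT-∘ : ∀ σ τ A → subT σ (subT τ A) ≡ subT (subT σ ∘ τ) A
subT-∘ σ τ (tv n)  = refl
subT-∘ σ τ (A ⇒ B) = cong₂ _⇒_ (subT-∘ σ τ A) (subT-∘ σ τ B)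
subT-∘ σ τ (A ∧ B) = cong₂ _∧_ (subT-∘ σ τ A) (subT-∘ σ τ B)
subT-∘ σ τ (all A) = cong all (trans (subT-∘ (extsT σ) (extsT τ) A) (subT-cong e A))
  where
  e : subT (extsT σ) ∘ extsT τ ≗ extsT (subT σ ∘ τ)
  e zero    = refl
  e (suc n) = subT-wkT σ (τ n)

subT-tv : ∀ A → subT tv A ≡ A
subT-tv (tv n)  = refl
subT-tv (A ⇒ B) = cong₂ _⇒_ (subT-tv A) (subT-tv B)
subT-tv (A ∧ B) = cong₂ _∧_ (subT-tv A) (subT-tv B)
subT-tv (all A) = cong all (trans (subT-cong (λ { zero → refl ; (suc n) → refl }) A) (subT-tv A))

wkT-[0:=] : ∀ A B → wkT A [0:= B ] ≡ A
wkT-[0:=] A B = trans (subT-renT (single B) suc A) (subT-tv A)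

subT-[0:=] : ∀ σ A B → subT σ (A [0:= B ]) ≡ subT (extsT σ) A [0:= subT σ B ]
subT-[0:=] σ A B = trans (subT-∘ σ (single B) A)
  (trans (subT-cong e A) (sym (subT-∘ (single (subT σ B)) (extsT σ) A)))
  where
  e : subT σ ∘ single B ≗ subT (single (subT σ B)) ∘ extsT σ
  e zero    = refl
  e (suc n) = sym (wkT-[0:=] (σ n) (subT σ B))

≅-subT : ∀ σ → A ≅ B → subT σ A ≅ subT σ B
≅-subT σ ≅-refl        = ≅-refl
≅-subT σ (≅-sym p)     = ≅-sym (≅-subT σ p)
≅-subT σ (≅-trans p q) = ≅-trans (≅-subT σ p) (≅-subT σ q)
≅-subT σ (≅-⇒ p q)     = ≅-⇒ (≅-subT σ p) (≅-subT σ q)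
≅-subT σ (≅-∧ p q)     = ≅-∧ (≅-subT σ p) (≅-subT σ q)
≅-subT σ (≅-all p)     = ≅-all (≅-subT (extsT σ) p)
≅-subT σ comm          = comm
≅-subT σ asso          = asso
≅-subT σ dist          = dist
≅-subT σ curry         = curry
≅-subT σ (p-comm {A})  = ≅-trans (≅-reflexive (cong (λ X → all (X ⇒ _)) (subT-wkT σ A))) p-comm
≅-subT σ p-dist        = p-dist

≅-renT : ∀ ρ → A ≅ B → renT ρ A ≅ renT ρ B
≅-renT {A} {B} ρ p = subst₂ _≅_ (sym (renT≗subT ρ A)) (sym (renT≗subT ρ B)) (≅-subT (tv ∘ ρ) p)

subTy-cong : ∀ {σ σ′} → σ ≗ σ′ → subTy σ ≗ subTy σ′
subTy-cong e (var x)    = refl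
subTy-cong e (lam A r)  = cong₂ lam (subT-cong e A) (subTy-cong e r)
subTy-cong e (r · s)    = cong₂ _·_ (subTy-cong e r) (subTy-cong e s)
subTy-cong e (pair r s) = cong₂ pair (subTy-cong e r) (subTy-cong e s)
subTy-cong e (proj A r) = cong₂ proj (subT-cong e A) (subTy-cong e r)
subTy-cong e (Lam r)    = cong Lam (subTy-cong (extsT-cong e) r)
subTy-cong e (tapp r A) = cong₂ tapp (subTy-cong e r) (subT-cong e A)

renTy≗subTy : ∀ ρ → renTy ρ ≗ subTy (tv ∘ ρ)
renTy≗subTy ρ (var x)    = refl
renTy≗subTy ρ (lam A r)  = cong₂ lam (renT≗subT ρ A) (renTy≗subTy ρ r)
renTy≗subTy ρ (r · s)    = cong₂ _·_ (renTy≗subTy ρ r) (renTy≗subTy ρ s)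
renTy≗subTy ρ (pair r s) = cong₂ pair (renTy≗subTy ρ r) (renTy≗subTy ρ s)
renTy≗subTy ρ (proj A r) = cong₂ proj (renT≗subT ρ A) (renTy≗subTy ρ r)
renTy≗subTy ρ (Lam r)    = cong Lam (trans (renTy≗subTy (extT ρ) r)
                                           (subTy-cong (λ { zero → refl ; (suc n) → refl }) r))
renTy≗subTy ρ (tapp r A) = cong₂ tapp (renTy≗subTy ρ r) (renT≗subT ρ A)

∋-map : ∀ (f : Type → Type) {x} → Γ ∋ x ⦂ A → map f Γ ∋ x ⦂ f A
∋-map f here      = here
∋-map f (there p) = there (∋-map f p)

∋-map⁻ : ∀ (f : Type → Type) {x} → map f Γ ∋ x ⦂ B → ∃[ A ] Γ ∋ x ⦂ A × B ≡ f A
∋-map⁻ {Γ = _ ∷ _} f here      = _ , here , refl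
∋-map⁻ {Γ = _ ∷ _} f (there p) = let A , q , e = ∋-map⁻ f p in A , there q , e

∋-functional : ∀ {x} → Γ ∋ x ⦂ A → Γ ∋ x ⦂ B → A ≡ B
∋-functional here      here      = refl
∋-functional (there p) (there q) = ∋-functional p q

map-subT-wkCtx : ∀ σ Γ → map (subT (extsT σ)) (wkCtx Γ) ≡ wkCtx (map (subT σ) Γ)
map-subT-wkCtx σ []      = refl
map-subT-wkCtx σ (A ∷ Γ) = cong₂ _∷_ (subT-wkT σ A) (map-subT-wkCtx σ Γ)

map-[0:=]-wkCtx : ∀ B Γ → map (subT (single B)) (wkCtx Γ) ≡ Γ
map-[0:=]-wkCtx B []      = refl
map-[0:=]-wkCtx B (A ∷ Γ) = cong₂ _∷_ (wkT-[0:=] A B) (map-[0:=]-wkCtx B Γ)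

⊢-subT : ∀ σ → Γ ⊢ r ⦂ A → map (subT σ) Γ ⊢ subTy σ r ⦂ subT σ A
⊢-subT σ (ax p)    = ax (∋-map (subT σ) p)
⊢-subT σ (≅e d p)  = ≅e (⊢-subT σ d) (≅-subT σ p)
⊢-subT σ (⇒i d)    = ⇒i (⊢-subT σ d)
⊢-subT σ (⇒e d e)  = ⇒e (⊢-subT σ d) (⊢-subT σ e)
⊢-subT σ (∧i d e)  = ∧i (⊢-subT σ d) (⊢-subT σ e)
⊢-subT σ (∧e d)    = ∧e (⊢-subT σ d)
⊢-subT {Γ} σ (∀i d) = ∀i (subst (λ Δ → Δ ⊢ _ ⦂ _) (map-subT-wkCtx σ Γ) (⊢-subT (extsT σ) d))
⊢-subT σ (∀e {A = A} {B = B} d) =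
  subst (λ X → _ ⊢ _ ⦂ X) (sym (subT-[0:=] σ A B)) (∀e (⊢-subT σ d))

⊢-wkT : Γ ⊢ r ⦂ A → wkCtx Γ ⊢ renTy suc r ⦂ wkT A
⊢-wkT {Γ} {r} {A} d =
  subst₂ (λ Δ X → Δ ⊢ renTy suc r ⦂ X)
    (sym (List.map-cong (renT≗subT suc) Γ)) (sym (renT≗subT suc A))
    (subst (λ t → _ ⊢ t ⦂ _) (sym (renTy≗subTy suc r)) (⊢-subT (tv ∘ suc) d))

⊢-[T0:=] : ∀ B → wkCtx Γ ⊢ r ⦂ A → Γ ⊢ r [T0:= B ] ⦂ A [0:= B ]
⊢-[T0:=] {Γ} B d = subst (λ Δ → Δ ⊢ _ ⦂ _) (map-[0:=]-wkCtx B Γ) (⊢-subT (single B) d)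

TypedRen : Ctx → Ctx → (ℕ → ℕ) → Set
TypedRen Γ Δ ρ = ∀ {x A} → Γ ∋ x ⦂ A → Δ ∋ ρ x ⦂ A

TypedSub : Ctx → Ctx → (ℕ → Term) → Set
TypedSub Γ Δ σ = ∀ {x A} → Γ ∋ x ⦂ A → Δ ⊢ σ x ⦂ A

⊢-ren : TypedRen Γ Δ ρ → Γ ⊢ r ⦂ A → Δ ⊢ ren ρ r ⦂ A
⊢-ren ok (ax p)   = ax (ok p)
⊢-ren ok (≅e d p) = ≅e (⊢-ren ok d) p
⊢-ren ok (⇒i d)   = ⇒i (⊢-ren ext d)
  where
  ext : TypedRen (_ ∷ _) (_ ∷ _) (extT _)
  ext here      = here
  ext (there p) = there (ok p)
⊢-ren ok (⇒e d e) = ⇒e (⊢-ren ok d) (⊢-ren ok e)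
⊢-ren ok (∧i d e) = ∧i (⊢-ren ok d) (⊢-ren ok e)
⊢-ren ok (∧e d)   = ∧e (⊢-ren ok d)
⊢-ren ok (∀i d)   = ∀i (⊢-ren wk d)
  where
  wk : TypedRen (wkCtx _) (wkCtx _) _
  wk p with _ , q , refl ← ∋-map⁻ wkT p = ∋-map wkT (ok q)
⊢-ren ok (∀e d)   = ∀e (⊢-ren ok d)

⊢-sub : ∀ {σ} → TypedSub Γ Δ σ → Γ ⊢ r ⦂ A → Δ ⊢ sub σ r ⦂ A
⊢-sub ok (ax p)   = ok p
⊢-sub ok (≅e d p) = ≅e (⊢-sub ok d) p
⊢-sub ok (⇒i d)   = ⇒i (⊢-sub ext d)
  where
  ext : TypedSub (_ ∷ _) (_ ∷ _) (exts _)
  ext here      = ax here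
  ext (there p) = ⊢-ren there (ok p)
⊢-sub ok (⇒e d e) = ⇒e (⊢-sub ok d) (⊢-sub ok e)
⊢-sub ok (∧i d e) = ∧i (⊢-sub ok d) (⊢-sub ok e)
⊢-sub ok (∧e d)   = ∧e (⊢-sub ok d)
⊢-sub ok (∀i d)   = ∀i (⊢-sub wk d)
  where
  wk : TypedSub (wkCtx _) (wkCtx _) (extsTy _)
  wk p with _ , q , refl ← ∋-map⁻ wkT p = ⊢-wkT (ok q)
⊢-sub ok (∀e d)   = ∀e (⊢-sub ok d)

⊢-[0:=ₜ] : A ∷ Γ ⊢ r ⦂ B → Γ ⊢ s ⦂ A → Γ ⊢ r [0:=ₜ s ] ⦂ B
⊢-[0:=ₜ] {A} {Γ} {s = s} d e = ⊢-sub single-ok d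
  where
  single-ok : TypedSub (A ∷ Γ) Γ (singleTm s)
  single-ok here      = e
  single-ok (there p) = ax p

var-inv : ∀ {x} → Γ ⊢ var x ⦂ C → ∃[ A ] Γ ∋ x ⦂ A × A ≅ C
var-inv (ax p)   = _ , p , ≅-refl
var-inv (≅e d p) = let A , q , i = var-inv d in A , q , ≅-trans i p

lam-inv : Γ ⊢ lam A r ⦂ C → ∃[ B ] A ∷ Γ ⊢ r ⦂ B × A ⇒ B ≅ C
lam-inv (⇒i d)   = _ , d , ≅-refl
lam-inv (≅e d p) = let B , q , i = lam-inv d in B , q , ≅-trans i p

app-inv : Γ ⊢ r · s ⦂ C → ∃₂ λ A B → Γ ⊢ r ⦂ A ⇒ B × Γ ⊢ s ⦂ A × B ≅ C
app-inv (⇒e d e) = _ , _ , d , e , ≅-refl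
app-inv (≅e d p) = let A , B , q , q′ , i = app-inv d in A , B , q , q′ , ≅-trans i p

pair-inv : Γ ⊢ pair r s ⦂ C → ∃₂ λ A B → Γ ⊢ r ⦂ A × Γ ⊢ s ⦂ B × A ∧ B ≅ C
pair-inv (∧i d e) = _ , _ , d , e , ≅-refl
pair-inv (≅e d p) = let A , B , q , q′ , i = pair-inv d in A , B , q , q′ , ≅-trans i p

proj-inv : Γ ⊢ proj A r ⦂ C → ∃[ B ] Γ ⊢ r ⦂ A ∧ B × A ≅ C
proj-inv (∧e d)   = _ , d , ≅-refl
proj-inv (≅e d p) = let B , q , i = proj-inv d in B , q , ≅-trans i p

Lam-inv : Γ ⊢ Lam r ⦂ C → ∃[ A ] wkCtx Γ ⊢ r ⦂ A × all A ≅ C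
Lam-inv (∀i d)   = _ , d , ≅-refl
Lam-inv (≅e d p) = let A , q , i = Lam-inv d in A , q , ≅-trans i p

tapp-inv : Γ ⊢ tapp r B ⦂ C → ∃[ A ] Γ ⊢ r ⦂ all A × A [0:= B ] ≅ C
tapp-inv (∀e d)   = _ , d , ≅-refl
tapp-inv (≅e d p) = let A , q , i = tapp-inv d in A , q , ≅-trans i p

-- allBody strips one outer quantifier from every prime factor of a type; every axiom of ≅
-- commutes with it. It is only meaningful when isAll holds (on a variable it returns junk).
allBody : Type → Type
allBody (tv n)  = tv n
allBody (A ⇒ B) = wkT A ⇒ allBody B
allBody (A ∧ B) = allBody A ∧ allBody B
allBody (all A) = A

isAll : Type → Bool
isAll (tv n)  = false
isAll (A ⇒ B) = isAll B
isAll (A ∧ B) = isAll A && isAll B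
isAll (all A) = true

allBody-cong : A ≅ B → allBody A ≅ allBody B
allBody-cong ≅-refl        = ≅-refl
allBody-cong (≅-sym p)     = ≅-sym (allBody-cong p)
allBody-cong (≅-trans p q) = ≅-trans (allBody-cong p) (allBody-cong q)
allBody-cong (≅-⇒ p q)     = ≅-⇒ (≅-renT suc p) (allBody-cong q)
allBody-cong (≅-∧ p q)     = ≅-∧ (allBody-cong p) (allBody-cong q)
allBody-cong (≅-all p)     = p
allBody-cong comm          = comm
allBody-cong asso          = asso
allBody-cong dist          = dist
allBody-cong curry         = curry
allBody-cong p-comm        = ≅-refl
allBody-cong p-dist        = ≅-refl

isAll-cong : A ≅ B → isAll A ≡ isAll B
isAll-cong ≅-refl                = refl
isAll-cong (≅-sym p)             = sym (isAll-cong p)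
isAll-cong (≅-trans p q)         = trans (isAll-cong p) (isAll-cong q)
isAll-cong (≅-⇒ p q)             = isAll-cong q
isAll-cong (≅-∧ p q)             = cong₂ _&&_ (isAll-cong p) (isAll-cong q)
isAll-cong (≅-all p)             = refl
isAll-cong (comm {A} {B})        = &&-comm (isAll A) (isAll B)
isAll-cong (asso {A} {B} {C})    = sym (&&-assoc (isAll A) (isAll B) (isAll C))
isAll-cong dist                  = refl
isAll-cong curry                 = refl
isAll-cong p-comm                = refl
isAll-cong p-dist                = refl

≅-all-allBody : ∀ A → T (isAll A) → A ≅ all (allBody A)
≅-all-allBody (A ⇒ B) t = ≅-trans (≅-⇒ ≅-refl (≅-all-allBody B t)) (≅-sym p-comm)
≅-all-allBody (A ∧ B) t =
  let tA , tB = Equivalence.to T-∧ t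
  in ≅-trans (≅-∧ (≅-all-allBody A tA) (≅-all-allBody B tB)) (≅-sym p-dist)
≅-all-allBody (all A) t = ≅-refl

all-injective : all A ≅ all B → A ≅ B
all-injective = allBody-cong

∧≅all-inv : B ∧ C ≅ all U → B ≅ all (allBody B) × C ≅ all (allBody C) × allBody B ∧ allBody C ≅ U
∧≅all-inv {B} {C} p =
  let tB , tC = Equivalence.to T-∧ (subst T (sym (isAll-cong p)) _)
  in ≅-all-allBody B tB , ≅-all-allBody C tC , allBody-cong p

⇒≅all-inv : A ⇒ V ≅ all U → V ≅ all (allBody V) × U ≅ wkT A ⇒ allBody V
⇒≅all-inv {V = V} p = ≅-all-allBody V (subst T (sym (isAll-cong p)) _) , ≅-sym (allBody-cong p)

module MapPermutation {a ℓ} (S : Setoid a ℓ) (f : Setoid.Carrier S → Setoid.Carrier S) where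
  open Setoid S using (_≈_) renaming (trans to ≈-trans)
  open PermutationSetoid S
  open SetoidEquality S using (_≋_; ≋-refl; ≋-trans)

  ↭-map⁻ : ∀ {xs zs} → xs ↭ map f zs → ∃[ ws ] xs ≋ map f ws × ws ↭ zs
  ↭-map⁻ p = go p ≋-refl
    where
    go : ∀ {xs ys zs} → xs ↭ ys → ys ≋ map f zs → ∃[ ws ] xs ≋ map f ws × ws ↭ zs
    go {zs = zs} (refl xs≋ys) ys≋ = zs , ≋-trans xs≋ys ys≋ , ↭-refl
    go {zs = z ∷ zs} (prep x≈y p) (y≈ ∷ ys≋) =
      let ws , xs≋ , ws↭ = go p ys≋ in z ∷ ws , ≈-trans x≈y y≈ ∷ xs≋ , ↭-prep z ws↭
    go {zs = z ∷ z′ ∷ zs} (swap x≈ y≈ p) (y′≈ ∷ x′≈ ∷ ys≋) =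
      let ws , xs≋ , ws↭ = go p ys≋
      in z′ ∷ z ∷ ws , ≈-trans x≈ x′≈ ∷ ≈-trans y≈ y′≈ ∷ xs≋ , ↭-swap z′ z ws↭
    go (trans p q) ys≋ =
      let ws , ys′≋ , ws↭ = go q ys≋
          vs , xs≋ , vs↭ = go p ys′≋
      in vs , xs≋ , ↭-trans vs↭ ws↭

  map-↭⁻ : (∀ {x y} → f x ≈ f y → x ≈ y) → ∀ {xs ys} → map f xs ↭ map f ys → xs ↭ ys
  map-↭⁻ f-reflects p =
    let ws , fxs≋fws , ws↭ys = ↭-map⁻ p
    in ↭-transˡ-≋ (Pointwise.map f-reflects (Pointwise.map⁻ f f fxs≋fws)) ws↭ys

  ++-≋-map⁻ : ∀ xs {ys ws} → xs ++ ys ≋ map f ws →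
              ∃₂ λ us vs → ws ≡ us ++ vs × xs ≋ map f us × ys ≋ map f vs
  ++-≋-map⁻ []                    p         = [] , _ , refl , [] , p
  ++-≋-map⁻ (x ∷ xs) {ws = w ∷ ws} (x≈ ∷ p) =
    let us , vs , ws≡ , xs≋ , ys≋ = ++-≋-map⁻ xs p
    in w ∷ us , vs , cong (w ∷_) ws≡ , x≈ ∷ xs≋ , ys≋

  ++-↭-map⁻ : ∀ xs {ys zs} → xs ++ ys ↭ map f zs →
              ∃₂ λ us vs → xs ≋ map f us × ys ≋ map f vs × us ++ vs ↭ zs
  ++-↭-map⁻ xs p with ws , xsys≋ , ws↭ ← ↭-map⁻ p
                  with us , vs , refl , xs≋ , ys≋ ← ++-≋-map⁻ xs xsys≋ = us , vs , xs≋ , ys≋ , ws↭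

-- Normal forms for type isomorphism

≅-setoid : Setoid 0ℓ 0ℓ
≅-setoid = record
  { Carrier       = Type
  ; _≈_           = _≅_
  ; isEquivalence = record { refl = ≅-refl ; sym = ≅-sym ; trans = ≅-trans }
  }

module ≅-Reasoning = SetoidReasoning ≅-setoid

module ↭ᵗ where
  open PermutationSetoid ≅-setoid public
  open PermutationProperties ≅-setoid public

open ↭ᵗ using () renaming (_↭_ to _↭ᵗ_)

variable
  Xs Ys : List Type

_⇒*_ : List Type → Type → Type
As ⇒* C = foldr _⇒_ C As

_∧*_ : Type → List Type → Type
A ∧* Xs = foldl _∧_ A Xs

conj : List⁺ Type → Type
conj (X ∷ Xs) = X ∧* Xs

allⁿ : ℕ → Type → Type
allⁿ zero    A = A
allⁿ (suc n) A = all (allⁿ n A)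

wkTⁿ : ℕ → Type → Type
wkTⁿ zero    A = A
wkTⁿ (suc n) A = wkTⁿ n (wkT A)

≅-wkTⁿ : ∀ n → A ≅ B → wkTⁿ n A ≅ wkTⁿ n B
≅-wkTⁿ zero    p = p
≅-wkTⁿ (suc n) p = ≅-wkTⁿ n (≅-renT suc p)

⇒-swap : A ⇒ B ⇒ C ≅ B ⇒ A ⇒ C
⇒-swap = ≅-trans (≅-sym curry) (≅-trans (≅-⇒ comm ≅-refl) curry)

∧-swapʳ : (A ∧ B) ∧ C ≅ (A ∧ C) ∧ B
∧-swapʳ = ≅-trans (≅-sym asso) (≅-trans (≅-∧ ≅-refl comm) asso)

⇒*-cong : Xs ↭ᵗ Ys → Xs ⇒* C ≅ Ys ⇒* C
⇒*-cong (↭ᵗ.refl Xs≋Ys)  = pointwise Xs≋Ys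
  where
  pointwise : Pointwise _≅_ Xs Ys → Xs ⇒* C ≅ Ys ⇒* C
  pointwise []         = ≅-refl
  pointwise (p ∷ Xs≋Ys) = ≅-⇒ p (pointwise Xs≋Ys)
⇒*-cong (↭ᵗ.prep p q)    = ≅-⇒ p (⇒*-cong q)
⇒*-cong (↭ᵗ.swap p p′ q) = ≅-trans (≅-⇒ p (≅-⇒ p′ (⇒*-cong q))) ⇒-swap
⇒*-cong (↭ᵗ.trans p q)   = ≅-trans (⇒*-cong p) (⇒*-cong q)

∧*-cong : A ≅ B → Xs ↭ᵗ Ys → A ∧* Xs ≅ B ∧* Ys
∧*-cong A≅B (↭ᵗ.refl Xs≋Ys)  = pointwise A≅B Xs≋Ys
  where
  pointwise : A ≅ B → Pointwise _≅_ Xs Ys → A ∧* Xs ≅ B ∧* Ys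
  pointwise A≅B []          = A≅B
  pointwise A≅B (p ∷ Xs≋Ys) = pointwise (≅-∧ A≅B p) Xs≋Ys
∧*-cong A≅B (↭ᵗ.prep p q)    = ∧*-cong (≅-∧ A≅B p) q
∧*-cong A≅B (↭ᵗ.swap p p′ q) = ∧*-cong (≅-trans (≅-∧ (≅-∧ A≅B p) p′) ∧-swapʳ) q
∧*-cong A≅B (↭ᵗ.trans p q)   = ≅-trans (∧*-cong A≅B p) (∧*-cong ≅-refl q)

∧*-congˡ : ∀ Xs → A ≅ B → A ∧* Xs ≅ B ∧* Xs
∧*-congˡ Xs p = ∧*-cong p (↭ᵗ.↭-refl {Xs})

∧*-assoc : ∀ Xs → (A ∧ B) ∧* Xs ≅ A ∧ (B ∧* Xs)
∧*-assoc []       = ≅-refl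
∧*-assoc (X ∷ Xs) = ≅-trans (∧*-congˡ Xs (≅-sym asso)) (∧*-assoc Xs)

∧*-⇒* : ∀ Xs → (A ∧* Xs) ⇒ C ≅ A ⇒ Xs ⇒* C
∧*-⇒* []       = ≅-refl
∧*-⇒* (X ∷ Xs) = ≅-trans (∧*-⇒* Xs) curry

all-⇒* : ∀ Xs → all (map wkT Xs ⇒* C) ≅ Xs ⇒* all C
all-⇒* []       = ≅-refl
all-⇒* (X ∷ Xs) = ≅-trans p-comm (≅-⇒ ≅-refl (all-⇒* Xs))

allⁿ-⇒* : ∀ n Xs → allⁿ n (map (wkTⁿ n) Xs ⇒* C) ≅ Xs ⇒* allⁿ n C
allⁿ-⇒* zero    Xs = ≅-reflexive (cong (_⇒* _) (List.map-id Xs))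
allⁿ-⇒* (suc n) Xs = ≅-trans
  (≅-all (≅-trans (≅-reflexive (cong (λ Ys → allⁿ n (Ys ⇒* _)) (List.map-∘ Xs))) (allⁿ-⇒* n (map wkT Xs))))
  (all-⇒* Xs)

-- conj has no unit, so instead of inducting on the permutation we locate the head Y of the target.
conj-↭ : ∀ {Xs Ys} → toList Xs ↭ᵗ toList Ys → conj Xs ≅ conj Ys
conj-↭ {X ∷ Xs} {Y ∷ Ys} p with ↭ᵗ.↭-split Y [] Ys p
... | [] , qs , X≅Y ∷ Xs≋qs , qs↭Ys = ∧*-cong X≅Y (↭ᵗ.↭-transˡ-≋ Xs≋qs qs↭Ys)
... | P ∷ ps , qs , X≅P ∷ Xs≋ , Pps↭Ys = begin
  X ∧* Xs                 ≈⟨ ∧*-cong X≅P (↭ᵗ.refl Xs≋) ⟩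
  P ∧* (ps ++ Y ∷ qs)     ≈⟨ ∧*-cong ≅-refl (↭ᵗ.↭-shift ps qs) ⟩
  (P ∧ Y) ∧* (ps ++ qs)   ≈⟨ ∧*-congˡ (ps ++ qs) comm ⟩
  Y ∧* (P ∷ ps ++ qs)     ≈⟨ ∧*-cong ≅-refl Pps↭Ys ⟩
  Y ∧* Ys                 ∎
  where open ≅-Reasoning

conj-⁺++⁺ : ∀ Xs Ys → conj (Xs ⁺++⁺ Ys) ≅ conj Xs ∧ conj Ys
conj-⁺++⁺ (X ∷ Xs) (Y ∷ Ys) =
  ≅-trans (≅-reflexive (List.foldl-++ _∧_ X Xs (Y ∷ Ys))) (∧*-assoc Ys)

-- atom n [A₁, …, Aₘ] k is the prime type ∀ⁿ. A₁ ⇒ ⋯ ⇒ Aₘ ⇒ Xₖ, its premises lying under the n binders.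
data Atom : Set where
  atom : ℕ → List Type → ℕ → Atom

⟦_⟧ᵃ : Atom → Type
⟦ atom n As k ⟧ᵃ = allⁿ n (As ⇒* tv k)

⟦_⟧ : List⁺ Atom → Type
⟦ Ps ⟧ = conj (List⁺.map ⟦_⟧ᵃ Ps)

allᵃ : Atom → Atom
allᵃ (atom n As k) = atom (suc n) As k

addPremises : List Type → Atom → Atom
addPremises Xs (atom n As k) = atom n (map (wkTⁿ n) Xs ++ As) k

mutual
  nf : Type → List⁺ Atom
  nf (tv k)  = List⁺.[ atom 0 [] k ]
  nf (A ⇒ B) = List⁺.map (addPremises (toList (factors A))) (nf B)
  nf (A ∧ B) = nf A ⁺++⁺ nf B
  nf (all A) = List⁺.map allᵃ (nf A)

  factors : Type → List⁺ Type
  factors A = List⁺.map ⟦_⟧ᵃ (nf A)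

-- Premises are compared by ≅ itself, not by their normal forms: this is all that ⇒-cancellation needs.
infix 4 _≈ᵃ_

data _≈ᵃ_ : Atom → Atom → Set where
  atom-cong : ∀ {n As Bs k} → As ↭ᵗ Bs → atom n As k ≈ᵃ atom n Bs k

variable
  p q : Atom

≈ᵃ-refl : p ≈ᵃ p
≈ᵃ-refl {atom n As k} = atom-cong ↭ᵗ.↭-refl

atom-setoid : Setoid 0ℓ 0ℓ
atom-setoid = record
  { Carrier       = Atom
  ; _≈_           = _≈ᵃ_
  ; isEquivalence = record
    { refl  = ≈ᵃ-refl
    ; sym   = λ { (atom-cong p) → atom-cong (↭ᵗ.↭-sym p) }
    ; trans = λ { (atom-cong p) (atom-cong q) → atom-cong (↭ᵗ.↭-trans p q) }
    }
  }

module ↭ᵃ where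
  open PermutationSetoid atom-setoid public
  open PermutationProperties atom-setoid public

open ↭ᵃ using () renaming (_↭_ to _↭ᵃ_)

⟦⟧ᵃ-cong : p ≈ᵃ q → ⟦ p ⟧ᵃ ≅ ⟦ q ⟧ᵃ
⟦⟧ᵃ-cong (atom-cong {n} p) = allⁿ-cong n (⇒*-cong p)
  where
  allⁿ-cong : ∀ n → A ≅ B → allⁿ n A ≅ allⁿ n B
  allⁿ-cong zero    p = p
  allⁿ-cong (suc n) p = ≅-all (allⁿ-cong n p)

⟦⟧-cong : ∀ {Ps Qs} → toList Ps ↭ᵃ toList Qs → ⟦ Ps ⟧ ≅ ⟦ Qs ⟧
⟦⟧-cong p = conj-↭ (↭ᵃ.map⁺ ≅-setoid ⟦⟧ᵃ-cong p)

⟦⟧-⁺++⁺ : ∀ Ps Qs → ⟦ Ps ⁺++⁺ Qs ⟧ ≅ ⟦ Ps ⟧ ∧ ⟦ Qs ⟧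
⟦⟧-⁺++⁺ Ps Qs = ≅-trans (≅-reflexive (cong conj (List⁺.map-⁺++⁺ ⟦_⟧ᵃ Ps Qs)))
                        (conj-⁺++⁺ (List⁺.map ⟦_⟧ᵃ Ps) (List⁺.map ⟦_⟧ᵃ Qs))

⟦map⟧-distrib : ∀ (F : Type → Type) {f} → (∀ {B C} → F B ∧ F C ≅ F (B ∧ C)) →
                (∀ p → ⟦ f p ⟧ᵃ ≅ F ⟦ p ⟧ᵃ) → ∀ Ps → ⟦ List⁺.map f Ps ⟧ ≅ F ⟦ Ps ⟧
⟦map⟧-distrib F {f} F-∧ f≅F (P ∷ Ps) = go Ps (f≅F P)
  where
  go : ∀ Ps → B ≅ F C → B ∧* map ⟦_⟧ᵃ (map f Ps) ≅ F (C ∧* map ⟦_⟧ᵃ Ps)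
  go []       p = p
  go (Q ∷ Ps) p = go Ps (≅-trans (≅-∧ p (f≅F Q)) F-∧)

⟦addPremises⟧ : ∀ Xs p → ⟦ addPremises (toList Xs) p ⟧ᵃ ≅ conj Xs ⇒ ⟦ p ⟧ᵃ
⟦addPremises⟧ (X ∷ Xs) (atom n As k) = begin
  allⁿ n ((map (wkTⁿ n) (X ∷ Xs) ++ As) ⇒* tv k)
    ≡⟨ cong (allⁿ n) (List.foldr-++ _⇒_ (tv k) (map (wkTⁿ n) (X ∷ Xs)) As) ⟩
  allⁿ n (map (wkTⁿ n) (X ∷ Xs) ⇒* (As ⇒* tv k))
    ≈⟨ allⁿ-⇒* n (X ∷ Xs) ⟩
  X ⇒ Xs ⇒* allⁿ n (As ⇒* tv k)
    ≈⟨ ∧*-⇒* Xs ⟨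
  (X ∧* Xs) ⇒ allⁿ n (As ⇒* tv k)
    ∎
  where open ≅-Reasoning

⟦map-addPremises⟧ : ∀ {Xs} → conj Xs ≅ A → ∀ Ps → ⟦ List⁺.map (addPremises (toList Xs)) Ps ⟧ ≅ A ⇒ ⟦ Ps ⟧
⟦map-addPremises⟧ {A} {Xs} p =
  ⟦map⟧-distrib (A ⇒_) (≅-sym dist) (λ q → ≅-trans (⟦addPremises⟧ Xs q) (≅-⇒ p ≅-refl))

≅-⟦nf⟧ : ∀ A → A ≅ ⟦ nf A ⟧
≅-⟦nf⟧ (tv k)  = ≅-refl
≅-⟦nf⟧ (A ⇒ B) = ≅-trans (≅-⇒ ≅-refl (≅-⟦nf⟧ B)) (≅-sym (⟦map-addPremises⟧ (≅-sym (≅-⟦nf⟧ A)) (nf B)))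
≅-⟦nf⟧ (A ∧ B) = ≅-trans (≅-∧ (≅-⟦nf⟧ A) (≅-⟦nf⟧ B)) (≅-sym (⟦⟧-⁺++⁺ (nf A) (nf B)))
≅-⟦nf⟧ (all A) = ≅-trans (≅-all (≅-⟦nf⟧ A))
  (≅-sym (⟦map⟧-distrib all (≅-sym p-dist) (λ { (atom n As k) → ≅-refl }) (nf A)))

nf-complete : toList (nf A) ↭ᵃ toList (nf B) → A ≅ B
nf-complete {A} {B} p = ≅-trans (≅-⟦nf⟧ A) (≅-trans (⟦⟧-cong p) (≅-sym (≅-⟦nf⟧ B)))

-- Renaming atoms is needed for the axiom ∀X.(A ⇒ B) ≅ A ⇒ ∀X.B, where A is weakened on the left.
extTⁿ : ℕ → (ℕ → ℕ) → ℕ → ℕ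
extTⁿ zero    ρ = ρ
extTⁿ (suc n) ρ = extTⁿ n (extT ρ)

renᵃ : (ℕ → ℕ) → Atom → Atom
renᵃ ρ (atom n As k) = atom n (map (renT (extTⁿ n ρ)) As) (extTⁿ n ρ k)

map-commute : ∀ {I J K L : Set} {f : J → L} {g : I → J} {h : K → L} {k : I → K} →
              (∀ x → f (g x) ≡ h (k x)) → ∀ xs → map f (map g xs) ≡ map h (map k xs)
map-commute e xs = trans (sym (List.map-∘ xs)) (trans (List.map-cong e xs) (List.map-∘ xs))

⟦renᵃ⟧ : ∀ ρ p → ⟦ renᵃ ρ p ⟧ᵃ ≡ renT ρ ⟦ p ⟧ᵃ
⟦renᵃ⟧ ρ (atom n As k) = sym (trans (renT-allⁿ n ρ) (cong (allⁿ n) (renT-⇒* As)))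
  where
  renT-allⁿ : ∀ n ρ → renT ρ (allⁿ n A) ≡ allⁿ n (renT (extTⁿ n ρ) A)
  renT-allⁿ zero    ρ = refl
  renT-allⁿ (suc n) ρ = cong all (renT-allⁿ n (extT ρ))
  renT-⇒* : ∀ As → renT ρ′ (As ⇒* C) ≡ map (renT ρ′) As ⇒* renT ρ′ C
  renT-⇒* []       = refl
  renT-⇒* (A ∷ As) = cong (_ ⇒_) (renT-⇒* As)

renT-wkTⁿ : ∀ n ρ A → renT (extTⁿ n ρ) (wkTⁿ n A) ≡ wkTⁿ n (renT ρ A)
renT-wkTⁿ zero    ρ A = refl
renT-wkTⁿ (suc n) ρ A = trans (renT-wkTⁿ n (extT ρ) (wkT A)) (cong (wkTⁿ n) (renT-extT-wkT ρ A))

addPremises-renᵃ : ∀ ρ Xs p → addPremises (map (renT ρ) Xs) (renᵃ ρ p) ≡ renᵃ ρ (addPremises Xs p)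
addPremises-renᵃ ρ Xs (atom n As k) = cong (λ Bs → atom n Bs (extTⁿ n ρ k)) (begin
  map (wkTⁿ n) (map (renT ρ) Xs) ++ map (renT (extTⁿ n ρ)) As
    ≡⟨ cong (_++ _) (map-commute (λ X → sym (renT-wkTⁿ n ρ X)) Xs) ⟩
  map (renT (extTⁿ n ρ)) (map (wkTⁿ n) Xs) ++ map (renT (extTⁿ n ρ)) As
    ≡⟨ List.map-++ (renT (extTⁿ n ρ)) (map (wkTⁿ n) Xs) As ⟨
  map (renT (extTⁿ n ρ)) (map (wkTⁿ n) Xs ++ As)
    ∎)
  where open ≡-Reasoning

mutual
  nf-renT : ∀ ρ A → toList (nf (renT ρ A)) ≡ map (renᵃ ρ) (toList (nf A))
  nf-renT ρ (tv k)  = refl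
  nf-renT ρ (A ⇒ B) = trans (cong₂ (λ Xs → map (addPremises Xs)) (factors-renT ρ A) (nf-renT ρ B))
                            (map-commute (addPremises-renᵃ ρ (toList (factors A))) (toList (nf B)))
  nf-renT ρ (A ∧ B) = trans (cong₂ _++_ (nf-renT ρ A) (nf-renT ρ B))
                            (sym (List.map-++ (renᵃ ρ) (toList (nf A)) (toList (nf B))))
  nf-renT ρ (all A) = trans (cong (map allᵃ) (nf-renT (extT ρ) A))
                            (map-commute (λ { (atom n As k) → refl }) (toList (nf A)))

  factors-renT : ∀ ρ A → toList (factors (renT ρ A)) ≡ map (renT ρ) (toList (factors A))
  factors-renT ρ A = trans (cong (map ⟦_⟧ᵃ) (nf-renT ρ A)) (map-commute (⟦renᵃ⟧ ρ) (toList (nf A)))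

addPremises-++ : ∀ Xs Ys p → addPremises (Xs ++ Ys) p ≡ addPremises Xs (addPremises Ys p)
addPremises-++ Xs Ys (atom n As k) = cong (λ Bs → atom n Bs k)
  (trans (cong (_++ As) (List.map-++ (wkTⁿ n) Xs Ys))
         (List.++-assoc (map (wkTⁿ n) Xs) (map (wkTⁿ n) Ys) As))

addPremises-factors-∧ : ∀ A B p →
  addPremises (toList (factors (A ∧ B))) p
    ≡ addPremises (toList (factors A)) (addPremises (toList (factors B)) p)
addPremises-factors-∧ A B p =
  trans (cong (λ Xs → addPremises Xs p) (List.map-++ ⟦_⟧ᵃ (toList (nf A)) (toList (nf B))))
        (addPremises-++ _ _ p)

allᵃ-addPremises : ∀ Xs p → allᵃ (addPremises (map wkT Xs) p) ≡ addPremises Xs (allᵃ p)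
allᵃ-addPremises Xs (atom n As k) = cong (λ Bs → atom (suc n) (Bs ++ As) k) (sym (List.map-∘ Xs))

addPremises-cong : Xs ↭ᵗ Ys → p ≈ᵃ q → addPremises Xs p ≈ᵃ addPremises Ys q
addPremises-cong Xs↭Ys (atom-cong {n} As↭Bs) = atom-cong (↭ᵗ.++⁺ (↭ᵗ.map⁺ ≅-setoid (≅-wkTⁿ n) Xs↭Ys) As↭Bs)

addPremises-cancel : ∀ Xs {p q} → addPremises Xs p ≈ᵃ addPremises Xs q → p ≈ᵃ q
addPremises-cancel Xs {atom n As k} {atom _ Bs _} (atom-cong p) =
  atom-cong (↭ᵗ.dropMiddle {vs = map (wkTⁿ n) Xs} [] [] p)

map-addPremises-cong : ∀ {ps qs} → Xs ↭ᵗ Ys → ps ↭ᵃ qs → map (addPremises Xs) ps ↭ᵃ map (addPremises Ys) qs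
map-addPremises-cong Xs↭Ys ps↭qs = ↭ᵃ.↭-trans
  (↭ᵃ.map⁺ atom-setoid (addPremises-cong ↭ᵗ.↭-refl) ps↭qs)
  (↭ᵃ.refl (Pointwise.map⁺ _ _ (Pointwise.refl (addPremises-cong Xs↭Ys ≈ᵃ-refl))))

nf-sound : A ≅ B → toList (nf A) ↭ᵃ toList (nf B)
nf-sound ≅-refl               = ↭ᵃ.↭-refl
nf-sound (≅-sym p)            = ↭ᵃ.↭-sym (nf-sound p)
nf-sound (≅-trans p q)        = ↭ᵃ.↭-trans (nf-sound p) (nf-sound q)
nf-sound (≅-⇒ p q)            =
  map-addPremises-cong (↭ᵃ.map⁺ ≅-setoid ⟦⟧ᵃ-cong (nf-sound p)) (nf-sound q)
nf-sound (≅-∧ p q)            = ↭ᵃ.++⁺ (nf-sound p) (nf-sound q)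
nf-sound (≅-all p)            = ↭ᵃ.map⁺ atom-setoid (λ { (atom-cong p) → atom-cong p }) (nf-sound p)
nf-sound (comm {A} {B})       = ↭ᵃ.++-comm (toList (nf A)) (toList (nf B))
nf-sound (asso {A} {B} {C})   =
  ↭ᵃ.↭-reflexive (sym (List.++-assoc (toList (nf A)) (toList (nf B)) (toList (nf C))))
nf-sound (dist {A} {B} {C})   = ↭ᵃ.↭-reflexive (List.map-++ (addPremises _) (toList (nf B)) (toList (nf C)))
nf-sound (curry {A} {B} {C})  = ↭ᵃ.↭-reflexive
  (trans (List.map-cong (addPremises-factors-∧ A B) (toList (nf C))) (List.map-∘ (toList (nf C))))
nf-sound (p-comm {A} {B})     = ↭ᵃ.↭-reflexive
  (trans (cong (λ Xs → map allᵃ (map (addPremises Xs) (toList (nf B)))) (factors-renT suc A))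
         (map-commute (allᵃ-addPremises (toList (factors A))) (toList (nf B))))
nf-sound (p-dist {A} {B})     = ↭ᵃ.↭-reflexive (List.map-++ allᵃ (toList (nf A)) (toList (nf B)))

factors-cong : A ≅ B → toList (factors A) ↭ᵗ toList (factors B)
factors-cong p = ↭ᵃ.map⁺ ≅-setoid ⟦⟧ᵃ-cong (nf-sound p)

⇒-cancelʳ : A ⇒ B ≅ A′ ⇒ B′ → A ≅ A′ → B ≅ B′
⇒-cancelʳ {A} p A≅A′ = nf-complete (map-↭⁻ (addPremises-cancel X)
  (↭ᵃ.↭-trans (nf-sound p) (map-addPremises-cong (factors-cong (≅-sym A≅A′)) ↭ᵃ.↭-refl)))
  where
  X = toList (factors A)
  open MapPermutation atom-setoid (addPremises X)

∧≅⇒-inv : B ∧ C ≅ A ⇒ U → ∃₂ λ U₁ U₂ → B ≅ A ⇒ U₁ × C ≅ A ⇒ U₂ × U₁ ∧ U₂ ≅ U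
∧≅⇒-inv {B} {C} {A} {U} p
  with MapPermutation.++-↭-map⁻ atom-setoid (addPremises (toList (factors A))) (toList (nf B)) (nf-sound p)
... | P ∷ Ps , Q ∷ Qs , B≋ , C≋ , PQ↭U =
  ⟦ P ∷ Ps ⟧ , ⟦ Q ∷ Qs ⟧ , factor B≋ , factor C≋ ,
  ≅-trans (≅-sym (⟦⟧-⁺++⁺ (P ∷ Ps) (Q ∷ Qs))) (≅-trans (⟦⟧-cong PQ↭U) (≅-sym (≅-⟦nf⟧ U)))
  where
  factor : ∀ {B Ps} → Pointwise _≈ᵃ_ (toList (nf B)) (map (addPremises (toList (factors A))) (toList Ps)) →
           B ≅ A ⇒ ⟦ Ps ⟧
  factor {B} {Ps} B≋ = ≅-trans (≅-⟦nf⟧ B)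
    (≅-trans (⟦⟧-cong (↭ᵃ.refl B≋)) (⟦map-addPremises⟧ (≅-sym (≅-⟦nf⟧ A)) Ps))

-- Types are unique up to isomorphism

⊢-unique : Γ ⊢ r ⦂ A → Γ ⊢ r ⦂ B → A ≅ B
⊢-unique {r = var x} d d′ =
  let _ , p , i = var-inv d ; _ , p′ , i′ = var-inv d′
  in ≅-trans (≅-sym i) (≅-trans (≅-reflexive (∋-functional p p′)) i′)
⊢-unique {r = lam A r} d d′ =
  let _ , e , i = lam-inv d ; _ , e′ , i′ = lam-inv d′
  in ≅-trans (≅-sym i) (≅-trans (≅-⇒ ≅-refl (⊢-unique e e′)) i′)
⊢-unique {r = r · s} d d′ =
  let _ , _ , e₁ , e₂ , i = app-inv d ; _ , _ , e₁′ , e₂′ , i′ = app-inv d′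
  in ≅-trans (≅-sym i) (≅-trans (⇒-cancelʳ (⊢-unique e₁ e₁′) (⊢-unique e₂ e₂′)) i′)
⊢-unique {r = pair r s} d d′ =
  let _ , _ , e₁ , e₂ , i = pair-inv d ; _ , _ , e₁′ , e₂′ , i′ = pair-inv d′
  in ≅-trans (≅-sym i) (≅-trans (≅-∧ (⊢-unique e₁ e₁′) (⊢-unique e₂ e₂′)) i′)
⊢-unique {r = proj A r} d d′ =
  let _ , _ , i = proj-inv d ; _ , _ , i′ = proj-inv d′
  in ≅-trans (≅-sym i) i′
⊢-unique {r = Lam r} d d′ =
  let _ , e , i = Lam-inv d ; _ , e′ , i′ = Lam-inv d′
  in ≅-trans (≅-sym i) (≅-trans (≅-all (⊢-unique e e′)) i′)
⊢-unique {r = tapp r B} d d′ =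
  let _ , e , i = tapp-inv d ; _ , e′ , i′ = tapp-inv d′
  in ≅-trans (≅-sym i) (≅-trans (≅-subT (single B) (all-injective (⊢-unique e e′))) i′)

-- Subject reduction and subject equivalence

TypesOf : Ctx → Term → Pred Type 0ℓ
TypesOf Γ r A = Γ ⊢ r ⦂ A

lam-⊆ : TypesOf (A ∷ Γ) r ⊆ TypesOf (A ∷ Γ) s → TypesOf Γ (lam A r) ⊆ TypesOf Γ (lam A s)
lam-⊆ r⊆s d = let _ , ⊢r , i = lam-inv d in ≅e (⇒i (r⊆s ⊢r)) i

appˡ-⊆ : TypesOf Γ r ⊆ TypesOf Γ s → TypesOf Γ (r · t) ⊆ TypesOf Γ (s · t)
appˡ-⊆ r⊆s d = let _ , _ , ⊢r , ⊢t , i = app-inv d in ≅e (⇒e (r⊆s ⊢r) ⊢t) i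

appʳ-⊆ : TypesOf Γ r ⊆ TypesOf Γ s → TypesOf Γ (t · r) ⊆ TypesOf Γ (t · s)
appʳ-⊆ r⊆s d = let _ , _ , ⊢t , ⊢r , i = app-inv d in ≅e (⇒e ⊢t (r⊆s ⊢r)) i

pairˡ-⊆ : TypesOf Γ r ⊆ TypesOf Γ s → TypesOf Γ (pair r t) ⊆ TypesOf Γ (pair s t)
pairˡ-⊆ r⊆s d = let _ , _ , ⊢r , ⊢t , i = pair-inv d in ≅e (∧i (r⊆s ⊢r) ⊢t) i

pairʳ-⊆ : TypesOf Γ r ⊆ TypesOf Γ s → TypesOf Γ (pair t r) ⊆ TypesOf Γ (pair t s)
pairʳ-⊆ r⊆s d = let _ , _ , ⊢t , ⊢r , i = pair-inv d in ≅e (∧i ⊢t (r⊆s ⊢r)) i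

proj-⊆ : TypesOf Γ r ⊆ TypesOf Γ s → TypesOf Γ (proj A r) ⊆ TypesOf Γ (proj A s)
proj-⊆ r⊆s d = let _ , ⊢r , i = proj-inv d in ≅e (∧e (r⊆s ⊢r)) i

Lam-⊆ : TypesOf (wkCtx Γ) r ⊆ TypesOf (wkCtx Γ) s → TypesOf Γ (Lam r) ⊆ TypesOf Γ (Lam s)
Lam-⊆ r⊆s d = let _ , ⊢r , i = Lam-inv d in ≅e (∀i (r⊆s ⊢r)) i

tapp-⊆ : TypesOf Γ r ⊆ TypesOf Γ s → TypesOf Γ (tapp r A) ⊆ TypesOf Γ (tapp s A)
tapp-⊆ r⊆s d = let _ , ⊢r , i = tapp-inv d in ≅e (∀e (r⊆s ⊢r)) i

subject-reduction : Γ ⊢ r ↪ s → TypesOf Γ r ⊆ TypesOf Γ s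
subject-reduction (β ⊢s) d =
  let _ , _ , ⊢λ , ⊢s′ , i = app-inv d ; _ , ⊢r , j = lam-inv ⊢λ
  in ≅e (⊢-[0:=ₜ] ⊢r ⊢s) (≅-trans (⇒-cancelʳ j (⊢-unique ⊢s ⊢s′)) i)
subject-reduction (βΛ {A = A}) d =
  let _ , ⊢Λ , i = tapp-inv d ; _ , ⊢r , j = Lam-inv ⊢Λ
  in ≅e (⊢-[T0:=] A ⊢r) (≅-trans (≅-subT (single A) (all-injective j)) i)
subject-reduction (βπ ⊢r) d = let _ , _ , i = proj-inv d in ≅e ⊢r i
subject-reduction (c-lam p)   = lam-⊆ (subject-reduction p)
subject-reduction (c-appl p)  = appˡ-⊆ (subject-reduction p)
subject-reduction (c-appr p)  = appʳ-⊆ (subject-reduction p)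
subject-reduction (c-pairl p) = pairˡ-⊆ (subject-reduction p)
subject-reduction (c-pairr p) = pairʳ-⊆ (subject-reduction p)
subject-reduction (c-proj p)  = proj-⊆ (subject-reduction p)
subject-reduction (c-Lam p)   = Lam-⊆ (subject-reduction p)
subject-reduction (c-tapp p)  = tapp-⊆ (subject-reduction p)

pair-comm : TypesOf Γ (pair r s) ⊆ TypesOf Γ (pair s r)
pair-comm d = let _ , _ , ⊢r , ⊢s , i = pair-inv d in ≅e (∧i ⊢s ⊢r) (≅-trans comm i)

pair-assoc : TypesOf Γ (pair r (pair s t)) ≐ TypesOf Γ (pair (pair r s) t)
pair-assoc =
  (λ d → let _ , _ , ⊢r , ⊢st , i = pair-inv d ; _ , _ , ⊢s , ⊢t , j = pair-inv ⊢st
         in ≅e (∧i (∧i ⊢r ⊢s) ⊢t) (≅-trans (≅-sym asso) (≅-trans (≅-∧ ≅-refl j) i))) ,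
  (λ d → let _ , _ , ⊢rs , ⊢t , i = pair-inv d ; _ , _ , ⊢r , ⊢s , j = pair-inv ⊢rs
         in ≅e (∧i ⊢r (∧i ⊢s ⊢t)) (≅-trans asso (≅-trans (≅-∧ j ≅-refl) i)))

lam-pair : TypesOf Γ (lam A (pair r s)) ≐ TypesOf Γ (pair (lam A r) (lam A s))
lam-pair =
  (λ d → let _ , ⊢rs , i = lam-inv d ; _ , _ , ⊢r , ⊢s , j = pair-inv ⊢rs
         in ≅e (∧i (⇒i ⊢r) (⇒i ⊢s)) (≅-trans (≅-sym dist) (≅-trans (≅-⇒ ≅-refl j) i))) ,
  (λ d → let _ , _ , ⊢λr , ⊢λs , i = pair-inv d ; _ , ⊢r , j = lam-inv ⊢λr ; _ , ⊢s , k = lam-inv ⊢λs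
         in ≅e (⇒i (∧i ⊢r ⊢s)) (≅-trans dist (≅-trans (≅-∧ j k) i)))

pair-app : TypesOf Γ (pair r s · t) ≐ TypesOf Γ (pair (r · t) (s · t))
pair-app =
  (λ d → let _ , _ , ⊢rs , ⊢t , i = app-inv d ; _ , _ , ⊢r , ⊢s , j = pair-inv ⊢rs
             _ , _ , r⇒ , s⇒ , k = ∧≅⇒-inv j
         in ≅e (∧i (⇒e (≅e ⊢r r⇒) ⊢t) (⇒e (≅e ⊢s s⇒) ⊢t)) (≅-trans k i)) ,
  (λ d → let _ , _ , ⊢rt , ⊢st , i = pair-inv d
             _ , _ , ⊢r , ⊢t , j = app-inv ⊢rt ; _ , _ , ⊢s , ⊢t′ , k = app-inv ⊢st
             ⊢s′ = ≅e ⊢s (≅-⇒ (⊢-unique ⊢t′ ⊢t) ≅-refl)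
         in ≅e (⇒e (≅e (∧i ⊢r ⊢s′) (≅-sym dist)) ⊢t) (≅-trans (≅-∧ j k) i))

app-pair : TypesOf Γ (r · pair s t) ≐ TypesOf Γ ((r · s) · t)
app-pair =
  (λ d → let _ , _ , ⊢r , ⊢st , i = app-inv d ; _ , _ , ⊢s , ⊢t , j = pair-inv ⊢st
         in ≅e (⇒e (⇒e (≅e ⊢r (≅-trans (≅-⇒ (≅-sym j) ≅-refl) curry)) ⊢s) ⊢t) i) ,
  (λ d → let _ , _ , ⊢rs , ⊢t , i = app-inv d ; _ , _ , ⊢r , ⊢s , j = app-inv ⊢rs
         in ≅e (⇒e (≅e ⊢r (≅-trans (≅-⇒ ≅-refl j) (≅-sym curry))) (∧i ⊢s ⊢t)) i)

Lam-lam : TypesOf Γ (Lam (lam (wkT A) r)) ≐ TypesOf Γ (lam A (Lam r))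
Lam-lam =
  (λ d → let _ , ⊢λ , i = Lam-inv d ; _ , ⊢r , j = lam-inv ⊢λ
         in ≅e (⇒i (∀i ⊢r)) (≅-trans (≅-sym p-comm) (≅-trans (≅-all j) i))) ,
  (λ d → let _ , ⊢Λ , i = lam-inv d ; _ , ⊢r , j = Lam-inv ⊢Λ
         in ≅e (∀i (⇒i ⊢r)) (≅-trans p-comm (≅-trans (≅-⇒ ≅-refl j) i)))

tapp-lam : TypesOf Γ (tapp (lam A r) B) ≐ TypesOf Γ (lam A (tapp r B))
tapp-lam {A = A} {B = B} =
  (λ d → let _ , ⊢λ , i = tapp-inv d ; V , ⊢r , j = lam-inv ⊢λ ; V≅ , U≅ = ⇒≅all-inv j
         in ≅e (⇒i (∀e (≅e ⊢r V≅)))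
               (≅-trans (≅-reflexive (cong (_⇒ allBody V [0:= B ]) (sym (wkT-[0:=] A B))))
                        (≅-trans (≅-subT (single B) (≅-sym U≅)) i))) ,
  (λ d → let _ , ⊢rB , i = lam-inv d ; U , ⊢r , j = tapp-inv ⊢rB
         in ≅e (∀e (≅e (⇒i ⊢r) (≅-sym p-comm)))
               (≅-trans (≅-reflexive (cong (_⇒ U [0:= B ]) (wkT-[0:=] A B))) (≅-trans (≅-⇒ ≅-refl j) i)))

Lam-pair : TypesOf Γ (Lam (pair r s)) ≐ TypesOf Γ (pair (Lam r) (Lam s))
Lam-pair =
  (λ d → let _ , ⊢rs , i = Lam-inv d ; _ , _ , ⊢r , ⊢s , j = pair-inv ⊢rs
         in ≅e (∧i (∀i ⊢r) (∀i ⊢s)) (≅-trans (≅-sym p-dist) (≅-trans (≅-all j) i))) ,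
  (λ d → let _ , _ , ⊢Λr , ⊢Λs , i = pair-inv d ; _ , ⊢r , j = Lam-inv ⊢Λr ; _ , ⊢s , k = Lam-inv ⊢Λs
         in ≅e (∀i (∧i ⊢r ⊢s)) (≅-trans p-dist (≅-trans (≅-∧ j k) i)))

tapp-pair : TypesOf Γ (tapp (pair r s) A) ≐ TypesOf Γ (pair (tapp r A) (tapp s A))
tapp-pair {A = A} =
  (λ d → let _ , ⊢rs , i = tapp-inv d ; _ , _ , ⊢r , ⊢s , j = pair-inv ⊢rs ; r∀ , s∀ , k = ∧≅all-inv j
         in ≅e (∧i (∀e (≅e ⊢r r∀)) (∀e (≅e ⊢s s∀))) (≅-trans (≅-subT (single A) k) i)) ,
  (λ d → let _ , _ , ⊢rA , ⊢sA , i = pair-inv d ; _ , ⊢r , j = tapp-inv ⊢rA ; _ , ⊢s , k = tapp-inv ⊢sA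
         in ≅e (∀e (≅e (∧i ⊢r ⊢s) (≅-sym p-dist))) (≅-trans (≅-∧ j k) i))

proj-Lam : TypesOf Γ (proj (all A) (Lam r)) ≐ TypesOf Γ (Lam (proj A r))
proj-Lam =
  (λ d → let _ , ⊢Λ , i = proj-inv d ; _ , ⊢r , j = Lam-inv ⊢Λ ; _ , _ , k = ∧≅all-inv (≅-sym j)
         in ≅e (∀i (∧e (≅e ⊢r (≅-sym k)))) i) ,
  (λ d → let _ , ⊢π , i = Lam-inv d ; _ , ⊢r , j = proj-inv ⊢π
         in ≅e (∧e (≅e (∀i ⊢r) p-dist)) (≅-trans (≅-all j) i))

tapp-proj : Γ ⊢ r ⦂ all (B ∧ C) →
            TypesOf Γ (tapp (proj (all B) r) A) ≐ TypesOf Γ (proj (B [0:= A ]) (tapp r A))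
tapp-proj {A = A} ⊢r =
  (λ d → let _ , ⊢π , i = tapp-inv d ; _ , _ , j = proj-inv ⊢π
         in ≅e (∧e (∀e ⊢r)) (≅-trans (≅-subT (single A) (all-injective j)) i)) ,
  (λ d → let _ , _ , i = proj-inv d in ≅e (∀e (∧e (≅e ⊢r p-dist))) i)

subject-equivalence : Γ ⊢ r ⇄ s → TypesOf Γ r ≐ TypesOf Γ s
subject-equivalence (e-sym p)          = Product.swap (subject-equivalence p)
subject-equivalence e-comm             = pair-comm , pair-comm
subject-equivalence e-asso             = pair-assoc
subject-equivalence e-distλ            = lam-pair
subject-equivalence e-distapp          = pair-app
subject-equivalence e-curry            = app-pair
subject-equivalence e-P-comm           = Lam-lam
subject-equivalence e-P-distλ          = tapp-lam
subject-equivalence e-P-distΛpair      = Lam-pair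
subject-equivalence e-P-distpairtapp   = tapp-pair
subject-equivalence e-P-πΛ             = proj-Lam
subject-equivalence (e-P-πtapp ⊢r)     = tapp-proj ⊢r
subject-equivalence (q-lam p)   = Product.map lam-⊆ lam-⊆ (subject-equivalence p)
subject-equivalence (q-appl p)  = Product.map appˡ-⊆ appˡ-⊆ (subject-equivalence p)
subject-equivalence (q-appr p)  = Product.map appʳ-⊆ appʳ-⊆ (subject-equivalence p)
subject-equivalence (q-pairl p) = Product.map pairˡ-⊆ pairˡ-⊆ (subject-equivalence p)
subject-equivalence (q-pairr p) = Product.map pairʳ-⊆ pairʳ-⊆ (subject-equivalence p)
subject-equivalence (q-proj p)  = Product.map proj-⊆ proj-⊆ (subject-equivalence p)
subject-equivalence (q-Lam p)   = Product.map Lam-⊆ Lam-⊆ (subject-equivalence p)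
subject-equivalence (q-tapp p)  = Product.map tapp-⊆ tapp-⊆ (subject-equivalence p)

mainTheorem1 : (Γ : Ctx) (r s : Term) (A : Type) →
    Γ ⊢ r ⦂ A → (Γ ⊢ r ↪ s) ⊎ (Γ ⊢ r ⇄ s) → Γ ⊢ s ⦂ A
mainTheorem1 Γ r s A ⊢r (inj₁ r↪s) = subject-reduction r↪s ⊢r
mainTheorem1 Γ r s A ⊢r (inj₂ r⇄s) = proj₁ (subject-equivalence r⇄s) ⊢r
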